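{- Let $A$ be a circular $m\times n$ matrix, $b\in\mathbb{Z}^m_+$, $x^*\in Q(A,b)\setminus Q^*(A,b)$, and $\Gamma$ a circuit with negative cost in $D(A,x^*)$. Then $p(\Gamma)>0$.
   Context: $[n]=\{1,\dots,n\}$ with addition mod $n$ (node $0$ identified with $n$); $[a,c)_n$ is the cyclic interval $\{a,\dots,c-1\}$ mod $n$. A $\{0,1\}$ $m\times n$ matrix $A$ is circular if each row $i$ is the incidence vector of $[\ell_i,\ell_i+k_i)_n$, $2\le k_i\le n-1$. $Q(A,b)=\{x\ge0:Ax\ge b\}$, $Q^*(A,b)=\mathrm{conv}(Q(A,b)\cap\mathbb{Z}^n)$. $D(A)$: node set $[n]$; forward arcs $a_i=(\ell_i-1,\ell_i+k_i-1)$ (length $k_i$), $i\in[m]$, $a_{m+j}=(j-1,j)$ (length 1), $j\in[n]$; reverse arcs $\bar a_i=(\ell_i+k_i-1,\ell_i-1)$ (length $-k_i$), $\bar a_{m+j}=(j,j-1)$ (length $-1$). A circuit is a simple directed circuit; its winding number $p(\Gamma)$ satisfies $p(\Gamma)n=\sum_{a\in E(\Gamma)}l(a)$. Costs: $\tilde A=\binom{A}{I}\in\{0,1\}^{(m+n)\times n}$, $d=\binom{b}{0}\in\mathbb{Z}^{m+n}$, $v$ the last column of $\tilde A$, $s^*=\tilde Ax^*-d$, $\mu=\lceil\mathbf 1^Tx^*\rceil-\mathbf1^Tx^*$, $c^+(x^*)=\mu(s^*-(1-\mu)v)$, $c^-(x^*)=(1-\mu)(s^*+\mu v)$. $D(A,x^*)$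 is $D(A)$ where arc $a_k$ has cost $c^+_k(x^*)$ and arc $\bar a_k$ has cost $c^-_k(x^*)$ ($k\in[m+n]$); the cost of a circuit is the sum of its arc costs.
   Formalization: The point $x^*$ has rational coordinates. -}

module Defs where

open import Data.Nat as ℕ using (ℕ; zero; suc; NonZero; _∸_; _<ᵇ_)
open import Data.Nat.DivMod using (_mod_)
open import Data.Fin using (Fin; toℕ)
import Data.Fin as Fin
open import Data.Integer as ℤ using (ℤ; +_)
open import Data.Rational as ℚ using (ℚ; 0ℚ; 1ℚ; _+_; _*_; _-_; _≤_; _<_; _/_)
open import Data.Bool using (Bool; true; false; if_then_else_)
open import Data.Sum using (_⊎_; inj₁; inj₂)
open import Data.Product using (_×_; _,_; Σ; proj₁; proj₂)
open import Data.List using (List; []; _∷_; map)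
open import Data.List.Relation.Unary.All using (All)
open import Data.List.Relation.Unary.Unique.Propositional using (Unique)
open import Data.Empty using (⊥)
open import Relation.Binary.PropositionalEquality using (_≡_)
open import Relation.Nullary using (¬_)

-- The ground set [n] = {1,…,n} with addition mod n is
-- represented by Fin n, an element r : Fin n standing for the residue
-- toℕ r mod n (so the element n of [n], i.e. node 0, is Fin.zero).
-- Columns of A are indexed the same way; the "last column" (column n)
-- is therefore the column Fin.zero.

res : (n : ℕ) .{{_ : NonZero n}} → ℕ → Fin n
res n a = a mod n

-- A circular matrix is given by its rows' start points ℓ i ∈ [n] and
-- lengths k i with 2 ≤ k i ≤ n - 1; row i is the incidence vector of the
-- cyclic interval [ℓ i, ℓ i + k i)_n.
record Circular (m n : ℕ) : Set where
  field
    ℓ    : Fin m → Fin n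
    k    : Fin m → ℕ
    k≥2  : ∀ i → 2 ℕ.≤ k i
    k≤n-1 : ∀ i → k i ℕ.≤ n ∸ 1

open Circular public

-- entry A_{i c} ∈ {0,1}:  c ∈ [ℓ_i, ℓ_i + k_i)_n  iff  (c - ℓ_i) mod n < k_i
entry : ∀ {m n} .{{_ : NonZero n}} → Circular m n → Fin m → Fin n → ℕ
entry {n = n} A i c =
  if toℕ (res n (toℕ c ℕ.+ (n ∸ toℕ (ℓ A i)))) <ᵇ k A i then 1 else 0

-- rationals (standing in for the reals)

ℕ→ℚ : ℕ → ℚ
ℕ→ℚ a = (+ a) / 1

ℤ→ℚ : ℤ → ℚ
ℤ→ℚ z = z / 1

Σℚ : ∀ {n} → (Fin n → ℚ) → ℚ
Σℚ {zero}  f = 0ℚ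
Σℚ {suc n} f = f Fin.zero + Σℚ (λ j → f (Fin.suc j))

sumℚ : List ℚ → ℚ
sumℚ []       = 0ℚ
sumℚ (q ∷ qs) = q + sumℚ qs

Ax : ∀ {m n} .{{_ : NonZero n}} → Circular m n → (Fin n → ℚ) → Fin m → ℚ
Ax A x i = Σℚ (λ j → ℕ→ℚ (entry A i j) * x j)

InQ : ∀ {m n} .{{_ : NonZero n}} → Circular m n → (Fin m → ℕ) → (Fin n → ℚ) → Set
InQ A b x = (∀ j → 0ℚ ≤ x j) × (∀ i → ℕ→ℚ (b i) ≤ Ax A x i)

-- x ∈ Q*(A,b) = conv(Q(A,b) ∩ ℤⁿ): x is a finite convex combination of
-- integer points of Q(A,b)
InQ* : ∀ {m n} .{{_ : NonZero n}} → Circular m n → (Fin m → ℕ) → (Fin n → ℚ) → Set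
InQ* {n = n} A b x =
  Σ (List (ℚ × (Fin n → ℤ))) λ ws →
    All (λ wz → (0ℚ ≤ proj₁ wz) × InQ A b (λ j → ℤ→ℚ (proj₂ wz j))) ws
    × sumℚ (map proj₁ ws) ≡ 1ℚ
    × (∀ j → x j ≡ sumℚ (map (λ wz → proj₁ wz * ℤ→ℚ (proj₂ wz j)) ws))

-- The digraph D(A).  Arc indices k ∈ [m+n] are Fin m ⊎ Fin n
-- (inj₁ i = a_i, inj₂ j = a_{m+j}); the Bool says forward (true: a_k)
-- or reverse (false: ā_k).

Arc : ℕ → ℕ → Set
Arc m n = (Fin m ⊎ Fin n) × Bool

fwdTail fwdHead : ∀ {m n} .{{_ : NonZero n}} → Circular m n → Fin m ⊎ Fin n → Fin n
fwdTail {n = n} A (inj₁ i) = res n (toℕ (ℓ A i) ℕ.+ (n ∸ 1))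
fwdTail {n = n} A (inj₂ j) = res n (toℕ j ℕ.+ (n ∸ 1))
fwdHead {n = n} A (inj₁ i) = res n (toℕ (ℓ A i) ℕ.+ k A i ℕ.+ (n ∸ 1))
fwdHead {n = n} A (inj₂ j) = j

fwdLen : ∀ {m n} → Circular m n → Fin m ⊎ Fin n → ℤ
fwdLen A (inj₁ i) = + (k A i)
fwdLen A (inj₂ j) = + 1

tail head : ∀ {m n} .{{_ : NonZero n}} → Circular m n → Arc m n → Fin n
tail A (κ , true)  = fwdTail A κ
tail A (κ , false) = fwdHead A κ
head A (κ , true)  = fwdHead A κ
head A (κ , false) = fwdTail A κ

len : ∀ {m n} → Circular m n → Arc m n → ℤ
len A (κ , true)  = fwdLen A κ
len A (κ , false) = ℤ.- fwdLen A κ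

Chain : ∀ {m n} .{{_ : NonZero n}} → Circular m n → Fin n → List (Arc m n) → Fin n → Set
Chain A u []       w = u ≡ w
Chain A u (e ∷ es) w = (tail A e ≡ u) × Chain A (head A e) es w

IsCircuit : ∀ {m n} .{{_ : NonZero n}} → Circular m n → List (Arc m n) → Set
IsCircuit A []       = ⊥
IsCircuit A (e ∷ es) =
  Chain A (tail A e) (e ∷ es) (tail A e) × Unique (map (tail A) (e ∷ es))

totalLength : ∀ {m n} → Circular m n → List (Arc m n) → ℤ
totalLength A []       = + 0
totalLength A (e ∷ es) = len A e ℤ.+ totalLength A es

IsWinding : ∀ {m n} → Circular m n → List (Arc m n) → ℤ → Set
IsWinding {n = n} A Γ p = p ℤ.* (+ n) ≡ totalLength A Γ

sStar : ∀ {m n} .{{_ : NonZero n}} → Circular m n → (Fin m → ℕ) → (Fin n → ℚ) → Fin m ⊎ Fin n → ℚ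
sStar A b x (inj₁ i) = Ax A x i - ℕ→ℚ (b i)
sStar A b x (inj₂ j) = x j

vLast : ∀ {m n} .{{_ : NonZero n}} → Circular m n → Fin m ⊎ Fin n → ℚ
vLast {n = n} A (inj₁ i) = ℕ→ℚ (entry A i (res n 0))
vLast {n = n} A (inj₂ j) = if toℕ j ℕ.≡ᵇ 0 then 1ℚ else 0ℚ

μ : ∀ {n} → (Fin n → ℚ) → ℚ
μ x = ℤ→ℚ (ℚ.⌈ Σℚ x ⌉) - Σℚ x

cPlus cMinus : ∀ {m n} .{{_ : NonZero n}} → Circular m n → (Fin m → ℕ) → (Fin n → ℚ) → Fin m ⊎ Fin n → ℚ
cPlus  A b x κ = μ x * (sStar A b x κ - (1ℚ - μ x) * vLast A κ)
cMinus A b x κ = (1ℚ - μ x) * (sStar A b x κ + μ x * vLast A κ)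

cost : ∀ {m n} .{{_ : NonZero n}} → Circular m n → (Fin m → ℕ) → (Fin n → ℚ) → Arc m n → ℚ
cost A b x (κ , true)  = cPlus A b x κ
cost A b x (κ , false) = cMinus A b x κ

circuitCost : ∀ {m n} .{{_ : NonZero n}} → Circular m n → (Fin m → ℕ) → (Fin n → ℚ) → List (Arc m n) → ℚ
circuitCost A b x Γ = sumℚ (map (cost A b x) Γ)

{-# OPTIONS --safe #-}
module Submission where

-- Label the nodes 0, …, n−1.  Every arc a of D(A) has length
-- l(a) = head(a) − tail(a) + w(a)·n, where the wrapping w(a) = ±v_a (sign by direction)
-- records whether a steps across the gap between n−1 and 0.  Around a closed walk the node
-- terms telescope, so p(Γ) = Σ w(a).  The costs read c⁺_k = μ s*_k − μ(1−μ) v_k and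
-- c⁻_k = (1−μ) s*_k + μ(1−μ) v_k with s* ≥ 0 and 0 ≤ μ ≤ 1, so every arc costs at least
-- −μ(1−μ) w(a) and Γ costs at least −μ(1−μ) p(Γ), which is nonnegative unless p(Γ) > 0.

open import Defs
open import Data.Nat using (ℕ; NonZero)
open import Data.Fin using (Fin)
open import Data.Integer using (ℤ; +_; +<+)
import Data.Integer as ℤ
open import Data.Rational using (ℚ; 0ℚ)
import Data.Rational as ℚ
open import Data.List using (List)
open import Data.Product using (_×_)
open import Relation.Nullary using (¬_)

open import Data.Bool using (Bool; true; false; if_then_else_)
open import Data.Fin using (toℕ)
open import Data.Nat using (zero; suc)
open import Data.List using ([]; _∷_)
open import Data.Product using (_,_; proj₁; proj₂)
open import Data.Sum using (_⊎_; inj₁; inj₂)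
open import Relation.Binary.PropositionalEquality
import Data.Integer.Properties as ℤ
import Data.Rational.Properties as ℚ

module _ where
  open import Data.Nat using (_+_; _*_; _∸_; _<ᵇ_; _≡ᵇ_; _≤_; _<_; s≤s)
  open import Data.Nat.Properties
  open import Data.Nat.DivMod
  open import Data.Fin.Properties using (toℕ-fromℕ<; toℕ<n)
  open import Relation.Nullary.Reflects using (ofʸ; ofⁿ)
  open import Algebra.Properties.CommutativeSemigroup +-commutativeSemigroup using (xy∙z≈xz∙y)
  open ≡-Reasoning

  [m+n]%d≡[m%d+n]%d : ∀ m n d .{{_ : NonZero d}} → (m + n) % d ≡ (m % d + n) % d
  [m+n]%d≡[m%d+n]%d m n d = begin
    (m + n) % d              ≡⟨ %-distribˡ-+ m n d ⟩
    (m % d + n % d) % d      ≡⟨ cong (λ r → (r + n % d) % d) (m%n%n≡m%n m d) ⟨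
    (m % d % d + n % d) % d  ≡⟨ %-distribˡ-+ (m % d) n d ⟨
    (m % d + n) % d          ∎

  [m+k]/[1+n]≡[n∸m<k] : ∀ {n m k} → m ≤ n → k ≤ suc n →
                        (m + k) / suc n ≡ (if n ∸ m <ᵇ k then 1 else 0)
  [m+k]/[1+n]≡[n∸m<k] {n} {m} {k} m≤n k≤1+n with n ∸ m <ᵇ k | <ᵇ-reflects-< (n ∸ m) k
  ... | true  | ofʸ n∸m<k = begin
    (m + k) / suc n              ≡⟨ m/n≡1+[m∸n]/n 1+n≤m+k ⟩
    1 + (m + k ∸ suc n) / suc n  ≡⟨ cong suc (m<n⇒m/n≡0 m+k∸[1+n]<1+n) ⟩
    1                            ∎
    where
    1+n≤m+k : suc n ≤ m + k
    1+n≤m+k = subst (_≤ m + k) (trans (+-suc m (n ∸ m)) (cong suc (m+[n∸m]≡n m≤n)))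
                    (+-monoʳ-≤ m n∸m<k)
    m+k∸[1+n]<1+n : m + k ∸ suc n < suc n
    m+k∸[1+n]<1+n = m<n+o⇒m∸n<o (m + k) (suc n) (+-mono-<-≤ (s≤s m≤n) k≤1+n)
  ... | false | ofⁿ n∸m≮k =
    m<n⇒m/n≡0 (s≤s (subst (m + k ≤_) (m+[n∸m]≡n m≤n) (+-monoʳ-≤ m (≮⇒≥ n∸m≮k))))

  module CyclicNodes (n' : ℕ) where

    n : ℕ
    n = suc n'

    toℕ-res : ∀ a → toℕ (res n a) ≡ a % n
    toℕ-res a = toℕ-fromℕ< (m%n<n a n)

    prev : Fin n → Fin n
    prev j = res n (toℕ j + n')

    toℕ-prev-zero : toℕ (prev Fin.zero) ≡ n'
    toℕ-prev-zero = trans (toℕ-res n') (m≤n⇒m%n≡m ≤-refl)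

    toℕ-prev-suc : ∀ j → toℕ (prev (Fin.suc j)) ≡ toℕ j
    toℕ-prev-suc j = begin
      toℕ (prev (Fin.suc j))  ≡⟨ toℕ-res (suc (toℕ j) + n') ⟩
      (suc (toℕ j) + n') % n  ≡⟨ cong (_% n) (+-suc (toℕ j) n') ⟨
      (toℕ j + n) % n         ≡⟨ [m+n]%n≡m%n (toℕ j) n ⟩
      toℕ j % n               ≡⟨ m≤n⇒m%n≡m (<⇒≤ (toℕ<n j)) ⟩
      toℕ j                   ∎

    unit-wraps : ∀ j → 1 + toℕ (prev j) ≡ toℕ j + (if toℕ j ≡ᵇ 0 then 1 else 0) * n
    unit-wraps Fin.zero    = cong suc (trans toℕ-prev-zero (sym (+-identityʳ n')))
    unit-wraps (Fin.suc j) = cong suc (trans (toℕ-prev-suc j) (sym (+-identityʳ (toℕ j))))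

    toℕ-res[n∸ℓ] : ∀ ℓ → toℕ (res n (n ∸ toℕ ℓ)) ≡ n' ∸ toℕ (prev ℓ)
    toℕ-res[n∸ℓ] Fin.zero = begin
      toℕ (res n n)             ≡⟨ trans (toℕ-res n) (n%n≡0 n) ⟩
      0                         ≡⟨ n∸n≡0 n' ⟨
      n' ∸ n'                   ≡⟨ cong (n' ∸_) toℕ-prev-zero ⟨
      n' ∸ toℕ (prev Fin.zero)  ∎
    toℕ-res[n∸ℓ] (Fin.suc ℓ) = begin
      toℕ (res n (n' ∸ toℕ ℓ))     ≡⟨ toℕ-res (n' ∸ toℕ ℓ) ⟩
      (n' ∸ toℕ ℓ) % n             ≡⟨ m≤n⇒m%n≡m (m∸n≤m n' (toℕ ℓ)) ⟩
      n' ∸ toℕ ℓ                   ≡⟨ cong (n' ∸_) (toℕ-prev-suc ℓ) ⟨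
      n' ∸ toℕ (prev (Fin.suc ℓ))  ∎

    toℕ-res[ℓ+k+n'] : ∀ ℓ k → toℕ (res n (toℕ ℓ + k + n')) ≡ (toℕ (prev ℓ) + k) % n
    toℕ-res[ℓ+k+n'] ℓ k = begin
      toℕ (res n (toℕ ℓ + k + n'))  ≡⟨ toℕ-res (toℕ ℓ + k + n') ⟩
      (toℕ ℓ + k + n') % n          ≡⟨ cong (_% n) (xy∙z≈xz∙y (toℕ ℓ) k n') ⟩
      (toℕ ℓ + n' + k) % n          ≡⟨ [m+n]%d≡[m%d+n]%d (toℕ ℓ + n') k n ⟩
      ((toℕ ℓ + n') % n + k) % n    ≡⟨ cong (λ t → (t + k) % n) (toℕ-res (toℕ ℓ + n')) ⟨
      (toℕ (prev ℓ) + k) % n        ∎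

    interval-wraps : ∀ ℓ k → k ≤ n →
      k + toℕ (prev ℓ) ≡
      toℕ (res n (toℕ ℓ + k + n')) + (if toℕ (res n (n ∸ toℕ ℓ)) <ᵇ k then 1 else 0) * n
    interval-wraps ℓ k k≤n = begin
      k + t                                  ≡⟨ +-comm k t ⟩
      t + k                                  ≡⟨ m≡m%n+[m/n]*n (t + k) n ⟩
      (t + k) % n + (t + k) / n * n          ≡⟨ cong₂ (λ r q → r + q * n)
                                                  (sym (toℕ-res[ℓ+k+n'] ℓ k))
                                                  ([m+k]/[1+n]≡[n∸m<k] (<⇒≤pred (toℕ<n (prev ℓ))) k≤n) ⟩
      h + (if n' ∸ t <ᵇ k then 1 else 0) * n ≡⟨ cong (λ r → h + (if r <ᵇ k then 1 else 0) * n)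
                                                  (toℕ-res[n∸ℓ] ℓ) ⟨
      h + (if toℕ (res n (n ∸ toℕ ℓ)) <ᵇ k then 1 else 0) * n ∎
      where
      t = toℕ (prev ℓ)
      h = toℕ (res n (toℕ ℓ + k + n'))

  module ForwardArcs {m n'} (A : Circular m (suc n')) where
    open CyclicNodes n'

    lastColumn : Fin m ⊎ Fin n → ℕ
    lastColumn (inj₁ i) = entry A i (res n 0)
    lastColumn (inj₂ j) = if toℕ j ≡ᵇ 0 then 1 else 0

    arcLength : Fin m ⊎ Fin n → ℕ
    arcLength (inj₁ i) = k A i
    arcLength (inj₂ _) = 1

    -- a_κ steps from n−1 across to 0 exactly when row κ of Ã has a 1 in its last column.
    fwd-arc-wraps : ∀ κ → arcLength κ + toℕ (fwdTail A κ) ≡ toℕ (fwdHead A κ) + lastColumn κ * n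
    fwd-arc-wraps (inj₁ i) = interval-wraps (ℓ A i) (k A i) (m≤n⇒m≤1+n (k≤n-1 A i))
    fwd-arc-wraps (inj₂ j) = unit-wraps j

module _ where
  open import Data.Integer using (_+_; _-_; _*_; -_)
  open import Data.Integer.Tactic.RingSolver using (solve-∀)
  import Data.Nat as ℕ
  open ≡-Reasoning

  +a≡h-t+v*n : ∀ a t h v n → a ℕ.+ t ≡ h ℕ.+ v ℕ.* n → + a ≡ (+ h - + t) + + v * + n
  +a≡h-t+v*n a t h v n eq = begin
    + a                      ≡⟨ a≡[a+t]-t (+ a) (+ t) ⟩
    (+ a + + t) - + t        ≡⟨ cong (_- + t) (ℤ.pos-+ a t) ⟨
    + (a ℕ.+ t) - + t        ≡⟨ cong (λ r → + r - + t) eq ⟩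
    + (h ℕ.+ v ℕ.* n) - + t  ≡⟨ cong (_- + t) (trans (ℤ.pos-+ h (v ℕ.* n))
                                                         (cong (_+_ (+ h)) (ℤ.pos-* v n))) ⟩
    (+ h + + v * + n) - + t  ≡⟨ [h+w]-t≡[h-t]+w (+ h) (+ v * + n) (+ t) ⟩
    (+ h - + t) + + v * + n  ∎
    where
    a≡[a+t]-t : ∀ a t → a ≡ (a + t) - t
    a≡[a+t]-t = solve-∀
    [h+w]-t≡[h-t]+w : ∀ h w t → (h + w) - t ≡ (h - t) + w
    [h+w]-t≡[h-t]+w = solve-∀

  module Winding {m n'} (A : Circular m (suc n')) where
    open CyclicNodes n' using (n)
    open ForwardArcs A

    wrapping : Arc m n → ℤ
    wrapping (κ , true)  = + lastColumn κ
    wrapping (κ , false) = - + lastColumn κ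

    fwdLen≡Δ+v*n : ∀ κ →
      fwdLen A κ ≡ (+ toℕ (fwdHead A κ) - + toℕ (fwdTail A κ)) + + lastColumn κ * + n
    fwdLen≡Δ+v*n κ = trans (fwdLen≡+arcLength κ)
      (+a≡h-t+v*n (arcLength κ) (toℕ (fwdTail A κ)) (toℕ (fwdHead A κ)) (lastColumn κ) n
                  (fwd-arc-wraps κ))
      where
      fwdLen≡+arcLength : ∀ κ → fwdLen A κ ≡ + arcLength κ
      fwdLen≡+arcLength (inj₁ _) = refl
      fwdLen≡+arcLength (inj₂ _) = refl

    len≡Δ+wrapping*n : ∀ e → len A e ≡ (+ toℕ (head A e) - + toℕ (tail A e)) + wrapping e * + n
    len≡Δ+wrapping*n (κ , true)  = fwdLen≡Δ+v*n κ
    len≡Δ+wrapping*n (κ , false) =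
      trans (cong -_ (fwdLen≡Δ+v*n κ)) (reverse h t (+ lastColumn κ) (+ n))
      where
      h = + toℕ (fwdHead A κ)
      t = + toℕ (fwdTail A κ)
      reverse : ∀ h t v n → - ((h - t) + v * n) ≡ (t - h) + (- v) * n
      reverse = solve-∀

    totalWrapping : List (Arc m n) → ℤ
    totalWrapping []       = + 0
    totalWrapping (e ∷ es) = wrapping e + totalWrapping es

    walk-length : ∀ {u w} es → Chain A u es w →
                  totalLength A es ≡ (+ toℕ w - + toℕ u) + totalWrapping es * + n
    walk-length {u} [] refl = empty (+ toℕ u) (+ n)
      where
      empty : ∀ u n → + 0 ≡ (u - u) + + 0 * n
      empty = solve-∀
    walk-length {w = w} (e ∷ es) (refl , walk) = begin
      len A e + totalLength A es
        ≡⟨ cong₂ _+_ (len≡Δ+wrapping*n e) (walk-length es walk) ⟩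
      ((h - t) + wrapping e * + n) + ((+ toℕ w - h) + W * + n)
        ≡⟨ telescope h t (+ toℕ w) (wrapping e) W (+ n) ⟩
      (+ toℕ w - t) + (wrapping e + W) * + n
        ∎
      where
      h = + toℕ (head A e)
      t = + toℕ (tail A e)
      W = totalWrapping es
      telescope : ∀ h t w a b n → ((h - t) + a * n) + ((w - h) + b * n) ≡ (w - t) + (a + b) * n
      telescope = solve-∀

    circuit-length : ∀ Γ → IsCircuit A Γ → totalLength A Γ ≡ totalWrapping Γ * + n
    circuit-length (e ∷ es) (closed , _) =
      trans (walk-length (e ∷ es) closed) (closing (+ toℕ (tail A e)) (totalWrapping (e ∷ es)) (+ n))
      where
      closing : ∀ u a n → (u - u) + a * n ≡ a * n
      closing = solve-∀

    winding≡totalWrapping : ∀ {Γ p} → IsCircuit A Γ → IsWinding A Γ p → p ≡ totalWrapping Γ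
    winding≡totalWrapping {Γ} {p} circuit winding =
      ℤ.*-cancelʳ-≡ p (totalWrapping Γ) (+ n) (trans winding (circuit-length Γ circuit))

module _ where
  open import Data.Rational
    using (_+_; _-_; _*_; -_; _≤_; 1ℚ; mkℚ; *≤*; floor; ceiling; nonNegative; nonPositive)
  open import Data.Rational.Literals using (fromℤ)
  open import Data.Integer.DivMod using (div-pos-is-/ℕ; [n/ℕd]*d≤n; n<s[n/ℕd]*d)
  open import Relation.Nullary.Decidable using (dec⇒maybe)
  open import Level using (0ℓ)
  open import Tactic.RingSolver using (solve-∀)
  open import Tactic.RingSolver.Core.AlmostCommutativeRing using (AlmostCommutativeRing; fromCommutativeRing)
  import Data.Rational.Unnormalised as ℚᵘ
  import Data.Rational.Unnormalised.Properties as ℚᵘ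
  import Data.Integer.Tactic.RingSolver as ℤ-Solver
  import Data.Nat as ℕ

  ℚ-ring : AlmostCommutativeRing 0ℓ 0ℓ
  ℚ-ring = fromCommutativeRing ℚ.+-*-commutativeRing (λ p → dec⇒maybe (0ℚ ℚ.≟ p))

  ℤ→ℚ≡fromℤ : ∀ z → ℤ→ℚ z ≡ fromℤ z
  ℤ→ℚ≡fromℤ z = ℚ.↥p/↧p≡p (fromℤ z)

  fromℤ-neg : ∀ z → fromℤ (ℤ.- z) ≡ - fromℤ z
  fromℤ-neg (+ zero)    = refl
  fromℤ-neg (+ suc _)   = refl
  fromℤ-neg ℤ.-[1+ _ ]  = refl

  fromℤ-+ : ∀ a b → fromℤ (a ℤ.+ b) ≡ fromℤ a + fromℤ b
  fromℤ-+ a b = ℚ.toℚᵘ-injective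
    (ℚᵘ.≃-trans (ℚᵘ.*≡* ([a+b]*1≡[a*1+b*1]*1 a b)) (ℚᵘ.≃-sym (ℚ.toℚᵘ-homo-+ (fromℤ a) (fromℤ b))))
    where
    [a+b]*1≡[a*1+b*1]*1 : ∀ a b → (a ℤ.+ b) ℤ.* + 1 ≡ (a ℤ.* + 1 ℤ.+ b ℤ.* + 1) ℤ.* + 1
    [a+b]*1≡[a*1+b*1]*1 = ℤ-Solver.solve-∀

  ⌊p⌋≤p : ∀ p → fromℤ ⌊ p ⌋ ≤ p
  ⌊p⌋≤p (mkℚ a d-1 _) = *≤* (subst₂ ℤ._≤_
    (cong (ℤ._* + suc d-1) (sym (div-pos-is-/ℕ a (suc d-1))))
    (sym (ℤ.*-identityʳ a))
    ([n/ℕd]*d≤n a (suc d-1)))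

  p≤1+⌊p⌋ : ∀ p → p ≤ 1ℚ + fromℤ ⌊ p ⌋
  p≤1+⌊p⌋ p@(mkℚ a d-1 _) = subst (p ≤_) (fromℤ-+ (+ 1) ⌊ p ⌋) (*≤* (subst₂ ℤ._≤_
    (sym (ℤ.*-identityʳ a))
    (cong (λ q → (+ 1 ℤ.+ q) ℤ.* + suc d-1) (sym (div-pos-is-/ℕ a (suc d-1))))
    (ℤ.<⇒≤ (n<s[n/ℕd]*d a (suc d-1)))))

  ⌈p⌉-p≡-p-⌊-p⌋ : ∀ p → ℤ→ℚ ⌈ p ⌉ - p ≡ - p - fromℤ ⌊ - p ⌋
  ⌈p⌉-p≡-p-⌊-p⌋ p@(mkℚ _ _ _) = begin
    ℤ→ℚ ⌈ p ⌉ - p            ≡⟨ cong (_- p) (ℤ→ℚ≡fromℤ ⌈ p ⌉) ⟩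
    fromℤ ⌈ p ⌉ - p          ≡⟨ cong (_- p) (fromℤ-neg ⌊ - p ⌋) ⟩
    - fromℤ ⌊ - p ⌋ - p      ≡⟨ swap (fromℤ ⌊ - p ⌋) p ⟩
    - p - fromℤ ⌊ - p ⌋      ∎
    where
    open ≡-Reasoning
    swap : ∀ f p → - f - p ≡ - p - f
    swap = solve-∀ ℚ-ring

  p≤q⇒0≤q-p : ∀ {p q} → p ≤ q → 0ℚ ≤ q - p
  p≤q⇒0≤q-p {p} {q} p≤q = subst (_≤ q - p) (ℚ.+-inverseʳ p) (ℚ.+-monoˡ-≤ (- p) p≤q)

  0≤p⇒q≤p+q : ∀ {p q} → 0ℚ ≤ p → q ≤ p + q
  0≤p⇒q≤p+q {p} {q} 0≤p = subst (_≤ p + q) (ℚ.+-identityˡ q) (ℚ.+-monoˡ-≤ q 0≤p)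

  0≤p*q : ∀ {p q} → 0ℚ ≤ p → 0ℚ ≤ q → 0ℚ ≤ p * q
  0≤p*q {p} {q} 0≤p 0≤q =
    ℚ.nonNegative⁻¹ _ {{ℚ.nonNeg*nonNeg⇒nonNeg p {{nonNegative 0≤p}} q {{nonNegative 0≤q}}}}

  0≤-[p*q] : ∀ {p q} → 0ℚ ≤ p → q ≤ 0ℚ → 0ℚ ≤ - (p * q)
  0≤-[p*q] {p} {q} 0≤p q≤0 = ℚ.neg-antimono-≤
    (ℚ.nonPositive⁻¹ _ {{ℚ.nonNeg*nonPos⇒nonPos p {{nonNegative 0≤p}} q {{nonPositive q≤0}}}})

  fromℤ-nonPos : ∀ {z} → z ℤ.≤ + 0 → fromℤ z ≤ 0ℚ
  fromℤ-nonPos {z} z≤0 = *≤* (subst (ℤ._≤ + 0) (sym (ℤ.*-identityʳ z)) z≤0)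

  0≤⌈p⌉-p : ∀ p → 0ℚ ≤ ℤ→ℚ ⌈ p ⌉ - p
  0≤⌈p⌉-p p = subst (0ℚ ≤_) (sym (⌈p⌉-p≡-p-⌊-p⌋ p)) (p≤q⇒0≤q-p (⌊p⌋≤p (- p)))

  ⌈p⌉-p≤1 : ∀ p → ℤ→ℚ ⌈ p ⌉ - p ≤ 1ℚ
  ⌈p⌉-p≤1 p = begin
    ℤ→ℚ ⌈ p ⌉ - p  ≡⟨ ⌈p⌉-p≡-p-⌊-p⌋ p ⟩
    - p - f        ≤⟨ ℚ.+-monoˡ-≤ (- f) (p≤1+⌊p⌋ (- p)) ⟩
    1ℚ + f - f     ≡⟨ [1+f]-f≡1 f ⟩
    1ℚ             ∎
    where
    open ℚ.≤-Reasoning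
    f = fromℤ ⌊ - p ⌋
    [1+f]-f≡1 : ∀ f → 1ℚ + f - f ≡ 1ℚ
    [1+f]-f≡1 = solve-∀ ℚ-ring

  module Costs {m n'} (A : Circular m (suc n')) (b : Fin m → ℕ) (x : Fin (suc n') → ℚ) where
    open ForwardArcs A using (lastColumn)
    open Winding A using (wrapping; totalWrapping)

    μ[1-μ] : ℚ
    μ[1-μ] = μ x * (1ℚ - μ x)

    slackWeight : Bool → ℚ
    slackWeight true  = μ x
    slackWeight false = 1ℚ - μ x

    0≤slackWeight : ∀ d → 0ℚ ≤ slackWeight d
    0≤slackWeight true  = 0≤⌈p⌉-p (Σℚ x)
    0≤slackWeight false = p≤q⇒0≤q-p (⌈p⌉-p≤1 (Σℚ x))

    vLast≡fromℤ : ∀ κ → vLast A κ ≡ fromℤ (+ lastColumn κ)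
    vLast≡fromℤ (inj₁ i) = ℤ→ℚ≡fromℤ _
    vLast≡fromℤ (inj₂ j) with toℕ j ℕ.≡ᵇ 0
    ... | true  = ℤ→ℚ≡fromℤ (+ 1)
    ... | false = ℤ→ℚ≡fromℤ (+ 0)

    cost≡slackWeight*s-μ[1-μ]*wrapping : ∀ κ d →
      cost A b x (κ , d) ≡ slackWeight d * sStar A b x κ - μ[1-μ] * fromℤ (wrapping (κ , d))
    cost≡slackWeight*s-μ[1-μ]*wrapping κ true =
      trans (cong (λ w → μ x * (s - (1ℚ - μ x) * w)) (vLast≡fromℤ κ)) (forward (μ x) s v)
      where
      s = sStar A b x κ
      v = fromℤ (+ lastColumn κ)
      forward : ∀ μ s v → μ * (s - (1ℚ - μ) * v) ≡ μ * s - μ * (1ℚ - μ) * v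
      forward = solve-∀ ℚ-ring
    cost≡slackWeight*s-μ[1-μ]*wrapping κ false =
      trans (cong (λ w → (1ℚ - μ x) * (s + μ x * w)) (vLast≡fromℤ κ)) (trans (backward (μ x) s v)
        (cong (λ w → (1ℚ - μ x) * s - μ[1-μ] * w) (sym (fromℤ-neg (+ lastColumn κ)))))
      where
      s = sStar A b x κ
      v = fromℤ (+ lastColumn κ)
      backward : ∀ μ s v → (1ℚ - μ) * (s + μ * v) ≡ (1ℚ - μ) * s - μ * (1ℚ - μ) * (- v)
      backward = solve-∀ ℚ-ring

    module _ (x∈Q : InQ A b x) where

      0≤sStar : ∀ κ → 0ℚ ≤ sStar A b x κ
      0≤sStar (inj₁ i) = p≤q⇒0≤q-p (proj₂ x∈Q i)
      0≤sStar (inj₂ j) = proj₁ x∈Q j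

      cost-lower-bound : ∀ e → - (μ[1-μ] * fromℤ (wrapping e)) ≤ cost A b x e
      cost-lower-bound (κ , d) =
        subst (- (μ[1-μ] * fromℤ (wrapping (κ , d))) ≤_)
              (sym (cost≡slackWeight*s-μ[1-μ]*wrapping κ d))
              (0≤p⇒q≤p+q (0≤p*q (0≤slackWeight d) (0≤sStar κ)))

      circuitCost-lower-bound : ∀ Γ → - (μ[1-μ] * fromℤ (totalWrapping Γ)) ≤ circuitCost A b x Γ
      circuitCost-lower-bound []       = ℚ.≤-reflexive (cong -_ (ℚ.*-zeroʳ μ[1-μ]))
      circuitCost-lower-bound (e ∷ es) = subst (_≤ circuitCost A b x (e ∷ es))
        (trans (distrib μ[1-μ] (fromℤ (wrapping e)) (fromℤ (totalWrapping es)))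
               (cong (λ w → - (μ[1-μ] * w)) (sym (fromℤ-+ (wrapping e) (totalWrapping es)))))
        (ℚ.+-mono-≤ (cost-lower-bound e) (circuitCost-lower-bound es))
        where
        distrib : ∀ c a b → - (c * a) + - (c * b) ≡ - (c * (a + b))
        distrib = solve-∀ ℚ-ring

      nonPositive-wrapping⇒0≤circuitCost : ∀ Γ → totalWrapping Γ ℤ.≤ + 0 → 0ℚ ≤ circuitCost A b x Γ
      nonPositive-wrapping⇒0≤circuitCost Γ wrapping≤0 = ℚ.≤-trans
        (0≤-[p*q] (0≤p*q (0≤slackWeight true) (0≤slackWeight false)) (fromℤ-nonPos wrapping≤0))
        (circuitCost-lower-bound Γ)

lemma4p3 : ∀ {m n} .{{_ : NonZero n}} (A : Circular m n) (b : Fin m → ℕ) (x : Fin n → ℚ)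
           → InQ A b x → ¬ InQ* A b x
           → (Γ : List (Arc m n)) → IsCircuit A Γ
           → circuitCost A b x Γ ℚ.< 0ℚ
           → (p : ℤ) → IsWinding A Γ p → + 0 ℤ.< p
lemma4p3 {n = zero} A b x _ _ (e ∷ _) _ _ _ _ with tail A e
... | ()
lemma4p3 {n = suc n'} A b x x∈Q _ Γ circuit negative p winding = ℤ.≰⇒> λ p≤0 →
  ℚ.<-irrefl refl (ℚ.≤-<-trans (nonPositive-wrapping⇒0≤circuitCost x∈Q Γ
    (subst (ℤ._≤ + 0) (winding≡totalWrapping circuit winding) p≤0)) negative)
  where
  open Winding A using (winding≡totalWrapping)
  open Costs A b x using (nonPositive-wrapping⇒0≤circuitCost)
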